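{- For $k\geq 1$, let $$V_k(x_1,\dots,x_k)=\sum_{n_1,\dots,n_k\geq 1}\frac{\prod_{j=1}^{k-1}\min(n_j,n_{j+1})}{n_1^{x_1}\cdots n_k^{x_k}}$$ and $$P_k(x_1,\dots,x_k)=\sum_{n_1,\dots,n_k\geq 1}\frac{\sum_{v_1\mid n_1,\dots,v_k\mid n_k}\prod_{j=1}^{k-1}\min(v_j,v_{j+1})\min\!\big(\frac{n_j}{v_j},\frac{n_{j+1}}{v_{j+1}}\big)}{n_1^{x_1}\cdots n_k^{x_k}}.$$ Then $P_k(x_1,\dots,x_k)=\big(V_k(x_1,\dots,x_k)\big)^2$.
   Context: $V_k$ is the Dirichlet generating function of parallelogram polyominoes of width $k$ ($x_i$ marks the height of the $i$-th column), and $P_k$ is the Dirichlet generating function of parallelogram polycubes of width $k$ ($x_i$ marks the volume of the $i$-th plateau). Sums over $v_i\mid n_i$ run over positive divisors; empty products equal $1$. The identity is one of formal multiple Dirichlet series. -}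

module Defs where

open import Data.Nat using (ℕ; zero; suc; _*_; _⊓_)
open import Data.Nat.DivMod using (_/_)
open import Data.Nat.Divisibility using (_∣?_)
open import Data.Bool using (if_then_else_)
open import Data.List using (List; []; _∷_; [_]; map; concatMap; upTo)
open import Data.Nat.ListAction using (sum)
open import Data.Product using (_×_; _,_; proj₁; proj₂)
open import Data.Vec using (Vec; []; _∷_)
import Data.Vec as Vec
open import Relation.Nullary.Decidable using (⌊_⌋)

-- A formal k-variable Dirichlet series  Σ_{n ∈ ℕ_{≥1}^k} a(n) / (n_1^{x_1} ⋯ n_k^{x_k})
-- is represented by its coefficient function a (only values at tuples of
-- positive integers matter).
DirSeries : ℕ → Set
DirSeries k = Vec ℕ k → ℕ

divPairs : ℕ → List (ℕ × ℕ)
divPairs n = concatMap (λ i → if ⌊ suc i ∣? n ⌋ then [ (suc i , n / suc i) ] else []) (upTo n)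

divTuples : ∀ {k} → Vec ℕ k → List (Vec (ℕ × ℕ) k)
divTuples [] = [] ∷ []
divTuples (n ∷ ns) =
  concatMap (λ p → map (λ t → p ∷ t) (divTuples ns)) (divPairs n)

-- Product of the multivariate Dirichlet series (coefficientwise:
-- (f g)(n) = Σ_{v_i ∣ n_i} f(v) g(n/v)).
_⋆_ : ∀ {k} → DirSeries k → DirSeries k → DirSeries k
(f ⋆ g) n = sum (map (λ t → f (Vec.map proj₁ t) * g (Vec.map proj₂ t)) (divTuples n))

minProd : ∀ {k} → Vec ℕ k → ℕ
minProd [] = 1
minProd (a ∷ []) = 1
minProd (a ∷ b ∷ r) = (a ⊓ b) * minProd (b ∷ r)

V : (k : ℕ) → DirSeries k
V k n = minProd n

pTerm : ∀ {k} → Vec (ℕ × ℕ) k → ℕ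
pTerm [] = 1
pTerm (p ∷ []) = 1
pTerm ((v , w) ∷ (v' , w') ∷ r) = ((v ⊓ v') * (w ⊓ w')) * pTerm ((v' , w') ∷ r)

P : (k : ℕ) → DirSeries k
P k n = sum (map pTerm (divTuples n))

-- The summand of P factors: for a tuple of divisor pairs (v_i , n_i/v_i),
--   ∏ min(v_j,v_{j+1}) · min(n_j/v_j , n_{j+1}/v_{j+1})
--     = (∏ min(v_j,v_{j+1})) · (∏ min(n_j/v_j , n_{j+1}/v_{j+1})),
-- which is exactly the summand of the Dirichlet convolution V ⋆ V.
module Submission where

open import Defs
open import Data.Nat using (ℕ; suc; _≤_; _*_; _⊓_)
open import Data.Nat.ListAction using (sum)
open import Data.Nat.Tactic.RingSolver using (solve-∀)
open import Data.List using (map)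
open import Data.List.Properties using (map-cong)
open import Data.Product using (_×_; _,_; proj₁; proj₂)
open import Data.Vec using (Vec; []; _∷_)
import Data.Vec as Vec
open import Data.Vec.Relation.Unary.All using (All)
open import Relation.Binary.PropositionalEquality using (_≡_; refl; cong)
open Relation.Binary.PropositionalEquality.≡-Reasoning

*-interchange : ∀ (a b c d : ℕ) → (a * b) * (c * d) ≡ (a * c) * (b * d)
*-interchange = solve-∀

pTerm≡minProd*minProd : ∀ {k} (t : Vec (ℕ × ℕ) k) →
  pTerm t ≡ minProd (Vec.map proj₁ t) * minProd (Vec.map proj₂ t)
pTerm≡minProd*minProd [] = refl
pTerm≡minProd*minProd (p ∷ []) = refl
pTerm≡minProd*minProd ((v , w) ∷ (v' , w') ∷ r) = begin
  ((v ⊓ v') * (w ⊓ w')) * pTerm t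
    ≡⟨ cong (((v ⊓ v') * (w ⊓ w')) *_) (pTerm≡minProd*minProd t) ⟩
  ((v ⊓ v') * (w ⊓ w')) * (minProd (Vec.map proj₁ t) * minProd (Vec.map proj₂ t))
    ≡⟨ *-interchange (v ⊓ v') (w ⊓ w') _ _ ⟩
  ((v ⊓ v') * minProd (Vec.map proj₁ t)) * ((w ⊓ w') * minProd (Vec.map proj₂ t))
    ∎
  where t = (v' , w') ∷ r

P≡V⋆V : ∀ {k} (n : Vec ℕ k) → P k n ≡ (V k ⋆ V k) n
P≡V⋆V n = cong sum (map-cong pTerm≡minProd*minProd (divTuples n))

-- The identity holds coefficientwise for every tuple.
theorem2 : (k : ℕ) → (n : Vec ℕ (suc k)) → All (λ m → 1 ≤ m) n →
    P (suc k) n ≡ (V (suc k) ⋆ V (suc k)) n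
theorem2 k n _ = P≡V⋆V n
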